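{- Let $\mathcal{H}$ be a set of wffs of type $o$ of $\mathcal{Q}^{\rm u}_{0}$, $\mathbf{A}_\alpha$ a wff of type $\alpha$, $\mathbf{x}_\alpha$ a variable, $\mathbf{B}_\beta$ a wff with $\mathbf{A}_\alpha$ free for $\mathbf{x}_\alpha$ in $\mathbf{B}_\beta$, and $\mathbf{C}_o$ a wff of type $o$. Suppose $\mathcal{H}\vdash\mathbf{A}_\alpha\downarrow$ and $\mathcal{H}\vdash\mathbf{C}_o$. Let $\mathbf{D}_o$ be the result of replacing one occurrence of $[\lambda\mathbf{x}_\alpha\mathbf{B}_\beta]\mathbf{A}_\alpha$ in $\mathbf{C}_o$ by an occurrence of $\mathrm{S}^{\mathbf{x}_\alpha}_{\mathbf{A}_\alpha}\mathbf{B}_\beta$, where this occurrence is not in a well-formed part $\lambda\mathbf{y}_\gamma\mathbf{E}_\delta$ of $\mathbf{C}_o$ such that $\mathbf{y}_\gamma$ is free in a member of $\mathcal{H}$ and free in $[\lambda\mathbf{x}_\alpha\mathbf{B}_\beta]\mathbf{A}_\alpha$. Then $\mathcal{H}\vdash\mathbf{D}_o$.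
   Context: SYNTAX. Type symbols: $\imath$, $o$, and $(\alpha\beta)$ for types $\alpha,\beta$ (functions from $\beta$ to $\alpha$). Primitive symbols: $[$, $]$, $\lambda$; denumerably many variables of each type; logical constants $\mathrm{Q}_{o\alpha\alpha}$ (every $\alpha$) and $\iota_{\alpha(o\alpha)}$ ($\alpha\neq o$); nonlogical constants of various types. Wffs: variables and primitive constants of type $\alpha$; $[\mathbf{A}_{\alpha\beta}\mathbf{B}_\beta]$ of type $\alpha$; $[\lambda\mathbf{x}_\beta\mathbf{A}_\alpha]$ of type $\alpha\beta$. $\mathrm{S}^{\mathbf{x}_\alpha}_{\mathbf{A}_\alpha}\mathbf{B}$ is the result of substituting $\mathbf{A}_\alpha$ for each free occurrence of $\mathbf{x}_\alpha$ in $\mathbf{B}$. ABBREVIATIONS. $[\mathbf{A}_\alpha=\mathbf{B}_\alpha]$ is $[\mathrm{Q}_{o\alpha\alpha}\mathbf{A}_\alpha\mathbf{B}_\alpha]$; $T_o$ is $[\mathrm{Q}_{ooo}=\mathrm{Q}_{ooo}]$; $F_o$ is $[[\lambda x_o T_o]=[\lambda x_o x_o]]$; $[\forall\mathbf{x}_\alpha\mathbf{A}_o]$ is $[[\lambda y_\alpha T_o]=[\lambda\mathbf{x}_\alpha\mathbf{A}_o]]$; $[\mathbf{A}_o\wedge\mathbf{B}_o]$ is $[[\lambda x_o\lambda y_o[[\lambda g_{ooo}[g_{ooo}T_oT_o]]=[\lambda g_{ooo}[g_{ooo}x_oy_o]]]]\mathbf{A}_o\mathbf{B}_o]$; $[\mathbf{A}_o\supset\mathbf{B}_o]$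 is $[[\lambda x_o\lambda y_o[x_o=[x_o\wedge y_o]]]\mathbf{A}_o\mathbf{B}_o]$; $[\sim\mathbf{A}_o]$ is $[\mathrm{Q}_{ooo}F_o\mathbf{A}_o]$; $[\mathbf{A}_o\vee\mathbf{B}_o]$ is $[[\lambda x_o\lambda y_o[\sim[[\sim x_o]\wedge[\sim y_o]]]]\mathbf{A}_o\mathbf{B}_o]$; $[\exists\mathbf{x}_\alpha\mathbf{A}_o]$ is $[\sim[\forall\mathbf{x}_\alpha\sim\mathbf{A}_o]]$; $[\exists_1\mathbf{x}_\alpha\mathbf{A}_o]$ is $[\exists y_\alpha[[\lambda\mathbf{x}_\alpha\mathbf{A}_o]=\mathrm{Q}_{o\alpha\alpha}y_\alpha]]$; $[\mathbf{A}_\alpha\downarrow]$ is $[\exists x_\alpha[x_\alpha=\mathbf{A}_\alpha]]$ ($x_\alpha$ not in $\mathbf{A}_\alpha$); $[\mathbf{A}_\alpha\uparrow]$ is $[\sim[\mathbf{A}_\alpha\downarrow]]$; $[\mathbf{A}_\alpha\simeq\mathbf{B}_\alpha]$ is $[[\mathbf{A}_\alpha\downarrow\vee\mathbf{B}_\alpha\downarrow]\supset[\mathbf{A}_\alpha=\mathbf{B}_\alpha]]$; $[\mathrm{I}\mathbf{x}_\alpha\mathbf{A}_o]$ is $[\iota_{\alpha(o\alpha)}[\lambda\mathbf{x}_\alpha\mathbf{A}_o]]$. PROOF SYSTEM. Axiom schemas A1 $[g_{oo}T_o\wedge g_{oo}F_o]=\forall x_o[g_{oo}x_o]$; A2 $[x_\alpha=y_\alpha]\supset[h_{o\alpha}x_\alpha=h_{o\alpha}y_\alpha]$;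 A3 $[f_{\alpha\beta}=g_{\alpha\beta}]=\forall x_\beta[f_{\alpha\beta}x_\beta\simeq g_{\alpha\beta}x_\beta]$; A4 $\mathbf{A}_\alpha\downarrow\supset[[\lambda\mathbf{x}_\alpha\mathbf{B}_\beta]\mathbf{A}_\alpha\simeq\mathrm{S}^{\mathbf{x}_\alpha}_{\mathbf{A}_\alpha}\mathbf{B}_\beta]$ ($\mathbf{A}_\alpha$ free for $\mathbf{x}_\alpha$ in $\mathbf{B}_\beta$); A5 $\mathbf{x}_\alpha\downarrow$; A6 $\mathbf{c}_\alpha\downarrow$ ($\mathbf{c}_\alpha$ primitive constant); A7 $[\lambda\mathbf{x}_\alpha\mathbf{B}_\beta]\downarrow$; A8 $\mathbf{A}_{o\beta}\mathbf{B}_\beta\downarrow$; A9 $[\mathbf{A}_{o\beta}\uparrow\vee\mathbf{B}_\beta\uparrow]\supset\sim[\mathbf{A}_{o\beta}\mathbf{B}_\beta]$; A10 $[\mathbf{A}_{\alpha\beta}\uparrow\vee\mathbf{B}_\beta\uparrow]\supset[\mathbf{A}_{\alpha\beta}\mathbf{B}_\beta]\uparrow$ ($\alpha\neq o$); A11 $\mathbf{A}_\alpha\downarrow\supset[\mathbf{B}_\alpha\downarrow\supset[[\mathbf{A}_\alpha\simeq\mathbf{B}_\alpha]\simeq[\mathbf{A}_\alpha=\mathbf{B}_\alpha]]]$; A12 $\exists_1\mathbf{x}_\alpha\mathbf{A}_o\supset[[\mathrm{I}\mathbf{x}_\alpha\mathbf{A}_o]\downarrow\wedge\mathrm{S}^{\mathbf{x}_\alpha}_{[\mathrm{I}\mathbf{x}_\alpha\mathbf{A}_o]}\mathbf{A}_o]$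 ($\alpha\neq o$, $\mathrm{I}\mathbf{x}_\alpha\mathbf{A}_o$ free for $\mathbf{x}_\alpha$ in $\mathbf{A}_o$); A13 $\sim[\exists_1\mathbf{x}_\alpha\mathbf{A}_o]\supset[\mathrm{I}\mathbf{x}_\alpha\mathbf{A}_o]\uparrow$ ($\alpha\neq o$). Rules: R1 from $\mathbf{A}_\alpha\simeq\mathbf{B}_\alpha$ and $\mathbf{C}_o$ infer $\mathbf{C}_o$ with one occurrence of $\mathbf{A}_\alpha$ (not an occurrence of a variable immediately preceded by $\lambda$) replaced by $\mathbf{B}_\alpha$; R2 from $\mathbf{A}_o$ and $\mathbf{A}_o\supset\mathbf{B}_o$ infer $\mathbf{B}_o$. A proof is a finite sequence of wffs$_o$ each an axiom instance or obtained from earlier members by R1 or R2. For a set $\mathcal{H}$ of wffs$_o$, a proof of $\mathbf{A}_o$ from $\mathcal{H}$ is a pair of finite sequences $\mathcal{S}_1,\mathcal{S}_2$ where $\mathcal{S}_1$ is a proof, $\mathbf{A}_o$ is the last member of $\mathcal{S}_2$, and each member of $\mathcal{S}_2$ is in $\mathcal{H}$, or in $\mathcal{S}_1$, or follows from two preceding members of $\mathcal{S}_2$ by R2, or follows from preceding members $\mathbf{A}_\alpha\simeq\mathbf{B}_\alpha$ and $\mathbf{C}_o$ by R1 provided the replaced occurrence is not in a well-formed part $\lambda\mathbf{x}_\beta\mathbf{E}_\gamma$ of $\mathbf{C}_o$ where $\mathbf{x}_\beta$ is free in a member of $\mathcal{H}$ and free in $\mathbf{A}_\alpha\simeq\mathbf{B}_\alpha$.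 $\mathcal{H}\vdash\mathbf{A}_o$ means such a proof exists. -}

module Defs where

open import Data.Nat using (ℕ; zero; suc; _⊔_; _≟_)
open import Data.Product using (Σ; _×_; _,_)
open import Data.Unit using (⊤)
open import Relation.Nullary using (¬_; yes; no; Dec)
open import Relation.Binary.PropositionalEquality using (_≡_; refl)

-- Types of Q^u_0.  fn α β is the type (αβ) of functions from β to α.

data Ty : Set where
  ι o : Ty
  fn  : Ty → Ty → Ty

_≟T_ : (α β : Ty) → Dec (α ≡ β)
ι ≟T ι = yes refl
ι ≟T o = no λ ()
ι ≟T fn _ _ = no λ ()
o ≟T ι = no λ ()
o ≟T o = yes refl
o ≟T fn _ _ = no λ ()
fn _ _ ≟T ι = no λ ()
fn _ _ ≟T o = no λ ()
fn α β ≟T fn γ δ with α ≟T γ | β ≟T δ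
... | yes refl | yes refl = yes refl
... | no ne | _ = no λ { refl → ne refl }
... | yes _ | no ne = no λ { refl → ne refl }

data NotO : Ty → Set where
  ι-notO  : NotO ι
  fn-notO : ∀ {α β} → NotO (fn α β)

data Wff (K : Ty → Set) : Ty → Set where
  var : ℕ → (α : Ty) → Wff K α
  Qc  : (α : Ty) → Wff K (fn (fn o α) α)
  ιc  : (α : Ty) → NotO α → Wff K (fn α (fn o α))
  kc  : ∀ {α} → K α → Wff K α
  app : ∀ {α β} → Wff K (fn α β) → Wff K β → Wff K α
  lam : ∀ {β} → ℕ → (α : Ty) → Wff K β → Wff K (fn β α)

module _ {K : Ty → Set} where

  maxName : ∀ {β} → Wff K β → ℕ
  maxName (var n _) = n
  maxName (Qc _) = 0
  maxName (ιc _ _) = 0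
  maxName (kc _) = 0
  maxName (app F X) = maxName F ⊔ maxName X
  maxName (lam n _ B) = n ⊔ maxName B

  data Free (n : ℕ) (α : Ty) : ∀ {β} → Wff K β → Set where
    fvar : Free n α (var n α)
    fappL : ∀ {γ δ} {F : Wff K (fn γ δ)} {X : Wff K δ} → Free n α F → Free n α (app F X)
    fappR : ∀ {γ δ} {F : Wff K (fn γ δ)} {X : Wff K δ} → Free n α X → Free n α (app F X)
    flam : ∀ {m γ δ} {B : Wff K δ} → ¬ (n ≡ m × α ≡ γ) → Free n α B → Free n α (lam m γ B)

  sub : ∀ {β} (n : ℕ) (α : Ty) → Wff K α → Wff K β → Wff K β
  sub n α A (var m γ) with m ≟ n | γ ≟T α
  ... | yes _ | yes refl = A
  ... | _ | _ = var m γ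
  sub n α A (Qc γ) = Qc γ
  sub n α A (ιc γ p) = ιc γ p
  sub n α A (kc c) = kc c
  sub n α A (app F X) = app (sub n α A F) (sub n α A X)
  sub n α A (lam m γ B) with m ≟ n | γ ≟T α
  ... | yes _ | yes _ = lam m γ B
  ... | _ | _ = lam m γ (sub n α A B)

  -- A_α is free for x^n_α in B: no free occurrence of x in B lies in a
  -- well-formed part λ y C of B with y free in A
  data FreeFor (n : ℕ) (α : Ty) (A : Wff K α) : ∀ {β} → Wff K β → Set where
    ffvar : ∀ {m γ} → FreeFor n α A (var m γ)
    ffQ   : ∀ {γ} → FreeFor n α A (Qc γ)
    ffι   : ∀ {γ p} → FreeFor n α A (ιc γ p)
    ffk   : ∀ {γ} {c : K γ} → FreeFor n α A (kc c)
    ffapp : ∀ {γ δ} {F : Wff K (fn γ δ)} {X : Wff K δ} →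
            FreeFor n α A F → FreeFor n α A X → FreeFor n α A (app F X)
    fflam₁ : ∀ {m γ δ} {B : Wff K δ} → ¬ Free n α (lam m γ B) → FreeFor n α A (lam m γ B)
    fflam₂ : ∀ {m γ δ} {B : Wff K δ} → ¬ Free m γ A → FreeFor n α A B →
             FreeFor n α A (lam m γ B)

  -- Abbreviations.  Fixed variable names: x = 0, y = 1, g = 2, h = 3, f = 4.

  infix 8 _≐_
  _≐_ : ∀ {α} → Wff K α → Wff K α → Wff K o
  _≐_ {α} A B = app (app (Qc α) A) B

  T : Wff K o
  T = Qc o ≐ Qc o

  F : Wff K o
  F = lam 0 o T ≐ lam 0 o (var 0 o)

  ∀' : (n : ℕ) (α : Ty) → Wff K o → Wff K o
  ∀' n α A = lam 1 α T ≐ lam n α A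

  _∧_ : Wff K o → Wff K o → Wff K o
  A ∧ B = app (app (lam 0 o (lam 1 o body)) A) B
    where
      g : Wff K (fn (fn o o) o)
      g = var 2 (fn (fn o o) o)
      body : Wff K o
      body = lam 2 (fn (fn o o) o) (app (app g T) T)
             ≐ lam 2 (fn (fn o o) o) (app (app g (var 0 o)) (var 1 o))

  _⊃_ : Wff K o → Wff K o → Wff K o
  A ⊃ B = app (app (lam 0 o (lam 1 o (var 0 o ≐ (var 0 o ∧ var 1 o)))) A) B

  ~_ : Wff K o → Wff K o
  ~ A = app (app (Qc o) F) A

  _∨_ : Wff K o → Wff K o → Wff K o
  A ∨ B = app (app (lam 0 o (lam 1 o (~ ((~ var 0 o) ∧ (~ var 1 o))))) A) B

  ∃' : (n : ℕ) (α : Ty) → Wff K o → Wff K o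
  ∃' n α A = ~ (∀' n α (~ A))

  -- ∃₁ x A := ∃ y [[λ x A] = Q y], y a variable distinct from x not occurring in A
  ∃₁ : (n : ℕ) (α : Ty) → Wff K o → Wff K o
  ∃₁ n α A = ∃' y α (lam n α A ≐ app (Qc α) (var y α))
    where y = suc (n ⊔ maxName A)

  -- A↓ := ∃ x [x = A], x not occurring in A
  _↓ : ∀ {α} → Wff K α → Wff K o
  _↓ {α} A = ∃' z α (var z α ≐ A)
    where z = suc (maxName A)

  _↑ : ∀ {α} → Wff K α → Wff K o
  A ↑ = ~ (A ↓)

  _≃_ : ∀ {α} → Wff K α → Wff K α → Wff K o
  A ≃ B = ((A ↓) ∨ (B ↓)) ⊃ (A ≐ B)

  I : (n : ℕ) (α : Ty) → NotO α → Wff K o → Wff K α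
  I n α p A = app (ιc α p) (lam n α A)

  data Axiom : Wff K o → Set where
    A1 : Axiom ((app (var 2 (fn o o)) T ∧ app (var 2 (fn o o)) F)
                ≐ ∀' 0 o (app (var 2 (fn o o)) (var 0 o)))
    A2 : (α : Ty) →
         Axiom ((var 0 α ≐ var 1 α) ⊃
                (app (var 3 (fn o α)) (var 0 α) ≐ app (var 3 (fn o α)) (var 1 α)))
    A3 : (α β : Ty) →
         Axiom ((var 4 (fn α β) ≐ var 2 (fn α β)) ≐
                ∀' 0 β (app (var 4 (fn α β)) (var 0 β) ≃ app (var 2 (fn α β)) (var 0 β)))
    A4 : ∀ {α β} (n : ℕ) (A : Wff K α) (B : Wff K β) → FreeFor n α A B →
         Axiom ((A ↓) ⊃ (app (lam n α B) A ≃ sub n α A B))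
    A5 : (n : ℕ) (α : Ty) → Axiom (var n α ↓)
    A6Q : (α : Ty) → Axiom (Qc α ↓)
    A6ι : (α : Ty) (p : NotO α) → Axiom (ιc α p ↓)
    A6k : ∀ {α} (c : K α) → Axiom (kc c ↓)
    A7 : ∀ {β} (n : ℕ) (α : Ty) (B : Wff K β) → Axiom (lam n α B ↓)
    A8 : ∀ {β} (A : Wff K (fn o β)) (B : Wff K β) → Axiom (app A B ↓)
    A9 : ∀ {β} (A : Wff K (fn o β)) (B : Wff K β) →
         Axiom (((A ↑) ∨ (B ↑)) ⊃ (~ app A B))
    A10 : ∀ {α β} → NotO α → (A : Wff K (fn α β)) (B : Wff K β) →
          Axiom (((A ↑) ∨ (B ↑)) ⊃ (app A B ↑))
    A11 : ∀ {α} (A B : Wff K α) →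
          Axiom ((A ↓) ⊃ ((B ↓) ⊃ ((A ≃ B) ≃ (A ≐ B))))
    A12 : ∀ {α} (p : NotO α) (n : ℕ) (A : Wff K o) →
          FreeFor n α (I n α p A) A →
          Axiom (∃₁ n α A ⊃ ((I n α p A ↓) ∧ sub n α (I n α p A) A))
    A13 : ∀ {α} (p : NotO α) (n : ℕ) (A : Wff K o) →
          Axiom ((~ ∃₁ n α A) ⊃ (I n α p A ↑))

  -- Repl Ok A B C D : D is the result of replacing one occurrence of A in C
  -- by B, where every λ-binder x^m_γ above that occurrence satisfies Ok m γ.
  -- (Variables immediately preceded by λ are not subterms here, so they are
  -- never replaced.)

  data Repl (Ok : ℕ → Ty → Set) {α : Ty} (A B : Wff K α) :
            ∀ {β} → Wff K β → Wff K β → Set where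
    here : Repl Ok A B A B
    appL : ∀ {γ δ} {G G' : Wff K (fn γ δ)} {X : Wff K δ} →
           Repl Ok A B G G' → Repl Ok A B (app G X) (app G' X)
    appR : ∀ {γ δ} {G : Wff K (fn γ δ)} {X X' : Wff K δ} →
           Repl Ok A B X X' → Repl Ok A B (app G X) (app G X')
    lamR : ∀ {m γ δ} {C D : Wff K δ} →
           Ok m γ → Repl Ok A B C D → Repl Ok A B (lam m γ C) (lam m γ D)

  NoRestriction : ℕ → Ty → Set
  NoRestriction _ _ = ⊤

  data Thm : Wff K o → Set where
    ax : ∀ {A} → Axiom A → Thm A
    R1 : ∀ {α} {A B : Wff K α} {C D : Wff K o} →
         Thm (A ≃ B) → Thm C → Repl NoRestriction A B C D → Thm D
    R2 : ∀ {A B} → Thm A → Thm (A ⊃ B) → Thm B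

  OkUnder : (Wff K o → Set) → ∀ {α} → Wff K α → ℕ → Ty → Set
  OkUnder H E m γ = ¬ ((Σ (Wff K o) λ h → H h × Free m γ h) × Free m γ E)

  infix 4 _⊢_
  data _⊢_ (H : Wff K o → Set) : Wff K o → Set where
    hyp : ∀ {A} → H A → H ⊢ A
    thm : ∀ {A} → Thm A → H ⊢ A
    R2  : ∀ {A B} → H ⊢ A → H ⊢ (A ⊃ B) → H ⊢ B
    R1  : ∀ {α} {A B : Wff K α} {C D : Wff K o} →
          H ⊢ (A ≃ B) → H ⊢ C → Repl (OkUnder H (A ≃ B)) A B C D → H ⊢ D

module Submission where

-- From H ⊢ A↓ and axiom A4, rule R2 gives  H ⊢ [λx B] A ≃ S^x_A B.
-- Rule R1 of derivations from H then rewrites the given occurrence of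
-- [λx B] A in C, provided that no binder λy above it has y free both in
-- a member of H and in the equation [λx B] A ≃ S^x_A B.  The hypothesis of
-- the theorem only restricts binders whose variable is free in [λx B] A,
-- so the proof reduces to a fact about free variables:
--
--   every variable free in  [λx B] A ≃ S^x_A B  is free in  [λx B] A.

open import Data.Nat using (ℕ; _≟_)
open import Data.Product using (_×_; _,_; proj₁; proj₂)
open import Data.Sum using (_⊎_; inj₁; inj₂; [_,_]; map₂)
import Data.Sum as Sum
open import Data.Empty using (⊥-elim)
open import Function using (_∘_)
open import Relation.Nullary using (¬_; yes; no)
open import Relation.Binary.PropositionalEquality using (_≡_; refl)
open import Defs

module _ {K : Ty → Set} where

  Closed : ∀ {β} → Wff K β → Set
  Closed E = ∀ {m γ} → ¬ Free m γ E

  freeVar : ∀ {m γ k τ} → Free {K} m γ (var k τ) → m ≡ k × γ ≡ τ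
  freeVar fvar = refl , refl

  freeEq : ∀ {m γ δ} {X Y : Wff K δ} → Free m γ (X ≐ Y) → Free m γ X ⊎ Free m γ Y
  freeEq (fappL (fappL ()))
  freeEq (fappL (fappR x)) = inj₁ x
  freeEq (fappR y) = inj₂ y

  T-closed : Closed {o} T
  T-closed (fappL (fappL ()))
  T-closed (fappL (fappR ()))
  T-closed (fappR ())

  F-closed : Closed {o} F
  F-closed f with freeEq f
  ... | inj₁ (flam _ t) = T-closed t
  ... | inj₂ (flam x≢x fvar) = x≢x (refl , refl)

  -- ~ X is  F = X  with F closed.
  freeNeg : ∀ {m γ} {X : Wff K o} → Free m γ (~ X) → Free m γ X
  freeNeg f with freeEq f
  ... | inj₁ φ = ⊥-elim (F-closed φ)
  ... | inj₂ x = x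

  -- The binary connectives are applications  [λx⁰ λx¹ body] X Y  whose body
  -- mentions no free variables besides x⁰_o and x¹_o; such a connective
  -- adds no free variables to its arguments.
  OnlyArgs : ∀ {β} → Wff K β → Set
  OnlyArgs body = ∀ {m γ} → Free m γ body → (m ≡ 0 × γ ≡ o) ⊎ (m ≡ 1 × γ ≡ o)

  freeConnective : ∀ {m γ β} {body : Wff K β} {X Y : Wff K o} → OnlyArgs body →
                   Free m γ (app (app (lam 0 o (lam 1 o body)) X) Y) →
                   Free m γ X ⊎ Free m γ Y
  freeConnective onlyArgs (fappL (fappL (flam x⁰≢ (flam x¹≢ b)))) =
    ⊥-elim ([ x⁰≢ , x¹≢ ] (onlyArgs b))
  freeConnective _ (fappL (fappR x)) = inj₁ x
  freeConnective _ (fappR y) = inj₂ y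

  -- Body of ∧:  [λg [g T T]] = [λg [g x⁰ x¹]].
  freeAnd : ∀ {m γ} {X Y : Wff K o} → Free m γ (X ∧ Y) → Free m γ X ⊎ Free m γ Y
  freeAnd = freeConnective λ
    { (fappL (fappL ()))
    ; (fappL (fappR (flam g≢ (fappL (fappL fvar))))) → ⊥-elim (g≢ (refl , refl))
    ; (fappL (fappR (flam _ (fappL (fappR t))))) → ⊥-elim (T-closed t)
    ; (fappL (fappR (flam _ (fappR t)))) → ⊥-elim (T-closed t)
    ; (fappR (flam g≢ (fappL (fappL fvar)))) → ⊥-elim (g≢ (refl , refl))
    ; (fappR (flam _ (fappL (fappR fvar)))) → inj₁ (refl , refl)
    ; (fappR (flam _ (fappR fvar))) → inj₂ (refl , refl)
    }

  -- Body of ⊃:  x⁰ = [x⁰ ∧ x¹].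
  freeImp : ∀ {m γ} {X Y : Wff K o} → Free m γ (X ⊃ Y) → Free m γ X ⊎ Free m γ Y
  freeImp = freeConnective λ
    { (fappL (fappL ()))
    ; (fappL (fappR fvar)) → inj₁ (refl , refl)
    ; (fappR c) → Sum.map freeVar freeVar (freeAnd c)
    }

  -- Body of ∨:  ~[[~ x⁰] ∧ [~ x¹]].
  freeOr : ∀ {m γ} {X Y : Wff K o} → Free m γ (X ∨ Y) → Free m γ X ⊎ Free m γ Y
  freeOr = freeConnective λ b →
    Sum.map (freeVar ∘ freeNeg) (freeVar ∘ freeNeg) (freeAnd (freeNeg b))

  -- X↓ is  ~[∀z ~[z = X]]  with z not occurring in X.
  freeDefined : ∀ {m γ δ} {X : Wff K δ} → Free m γ (X ↓) → Free m γ X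
  freeDefined f with freeEq (freeNeg f)
  ... | inj₁ (flam _ t) = ⊥-elim (T-closed t)
  ... | inj₂ (flam z≢ b) with freeEq (freeNeg b)
  ...   | inj₁ fvar = ⊥-elim (z≢ (refl , refl))
  ...   | inj₂ x = x

  -- X ≃ Y is  [X↓ ∨ Y↓] ⊃ [X = Y].
  freeQuasiEq : ∀ {m γ δ} {X Y : Wff K δ} → Free m γ (X ≃ Y) → Free m γ X ⊎ Free m γ Y
  freeQuasiEq f =
    [ Sum.map freeDefined freeDefined ∘ freeOr , freeEq ] (freeImp f)

  mapUnderλ : ∀ {m γ n α δ δ'} {B : Wff K δ} {B' : Wff K δ'} → (Free m γ B → Free m γ B') →
              Free m γ (lam n α B) → Free m γ (lam n α B')
  mapUnderλ f (flam x≢ b) = flam x≢ (f b)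

  freeSub : ∀ {m γ n α δ} (A : Wff K α) (B : Wff K δ) → Free m γ (sub n α A B) →
            Free m γ A ⊎ Free m γ (lam n α B)
  freeSub {n = n} {α} A (var k τ) f with k ≟ n | τ ≟T α
  freeSub A (var k τ) f    | yes refl | yes refl = inj₁ f
  freeSub A (var k τ) fvar | yes _    | no τ≢α  = inj₂ (flam (τ≢α ∘ proj₂) fvar)
  freeSub A (var k τ) fvar | no k≢n   | _       = inj₂ (flam (k≢n ∘ proj₁) fvar)
  freeSub A (Qc _) ()
  freeSub A (ιc _ _) ()
  freeSub A (kc _) ()
  freeSub A (app G X) (fappL g) = map₂ (mapUnderλ fappL) (freeSub A G g)
  freeSub A (app G X) (fappR x) = map₂ (mapUnderλ fappR) (freeSub A X x)
  -- A binder λx leaves its body untouched; other binders are passed through.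
  freeSub {n = n} {α} A (lam k τ B) f with k ≟ n | τ ≟T α
  freeSub A (lam k τ B) (flam x≢ b)   | yes refl | yes refl = inj₂ (flam x≢ (flam x≢ b))
  freeSub A (lam k τ B) (flam y≢ b)   | yes _    | no _     =
    map₂ (mapUnderλ (flam y≢)) (freeSub A B b)
  freeSub A (lam k τ B) (flam y≢ b)   | no _     | _        =
    map₂ (mapUnderλ (flam y≢)) (freeSub A B b)

  freeβ : ∀ {m γ n α δ} (A : Wff K α) (B : Wff K δ) →
          Free m γ (app (lam n α B) A ≃ sub n α A B) → Free m γ (app (lam n α B) A)
  freeβ A B f with freeQuasiEq f
  ... | inj₁ redex = redex
  ... | inj₂ s = [ fappR , fappL ] (freeSub A B s)

  okUnder-mono : ∀ (H : Wff K o → Set) {α α'} {E : Wff K α} {E' : Wff K α'} →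
                 (∀ {m γ} → Free m γ E' → Free m γ E) →
                 ∀ {m γ} → OkUnder H E m γ → OkUnder H E' m γ
  okUnder-mono H E'⊆E ok (inH , free') = ok (inH , E'⊆E free')

  repl-mono : ∀ {Ok Ok' : ℕ → Ty → Set} {α β} {X Y : Wff K α} {C D : Wff K β} →
              (∀ {m γ} → Ok m γ → Ok' m γ) → Repl Ok X Y C D → Repl Ok' X Y C D
  repl-mono weaken here = here
  repl-mono weaken (appL r) = appL (repl-mono weaken r)
  repl-mono weaken (appR r) = appR (repl-mono weaken r)
  repl-mono weaken (lamR ok r) = lamR (weaken ok) (repl-mono weaken r)

  ⊢β : ∀ (H : Wff K o → Set) {α β} (n : ℕ) (A : Wff K α) (B : Wff K β) →
       FreeFor n α A B → H ⊢ (A ↓) → H ⊢ (app (lam n α B) A ≃ sub n α A B)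
  ⊢β H n A B freeFor A↓ = R2 A↓ (thm (ax (A4 n A B freeFor)))

mainTheorem9 : {K : Ty → Set} (H : Wff K o → Set) {α β : Ty}
    (n : ℕ) (A : Wff K α) (B : Wff K β) (C D : Wff K o) →
    FreeFor n α A B →
    H ⊢ (A ↓) →
    H ⊢ C →
    Repl (OkUnder H (app (lam n α B) A)) (app (lam n α B) A) (sub n α A B) C D →
    H ⊢ D
mainTheorem9 H n A B C D freeFor A↓ ⊢C replacement =
  R1 (⊢β H n A B freeFor A↓) ⊢C
     (repl-mono (okUnder-mono H (freeβ A B)) replacement)
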